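{- Let $T,U$ be independent indeterminates and $C:=\mathbb{Q}(T,U)$. Define $h_n\in\mathbb{Z}[T,U]$ by $h_0:=T$ and $h_{n+1}:=h_n^2-2U^{2^n}$ ($n\ge0$). Let $F(X):=X-f(X)\big/\frac{df}{dX}(X)=\frac{X^2-U}{2X-T}\in C(X)$ for $f=X^2-TX+U$, let $F^{(0)}(X):=X$, and let $F^{(n)}$ be the $n$-fold iterate of $F$. Then for all $n\ge0$, $$F^{(n+1)}(0)-F^{(n)}(0)=\frac{U^{2^n}}{h_0h_1\cdots h_n},\qquad F^{(n+1)}(T)-F^{(n)}(T)=-\frac{U^{2^n}}{h_0h_1\cdots h_n}$$ hold in $C$. -}

module Defs where

open import Data.Nat using (ℕ; zero; suc)
import Data.Nat as ℕ
open import Data.Integer as ℤ using (ℤ; +_; 0ℤ; 1ℤ)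
open import Data.List using (List; []; _∷_; map)
open import Data.List.Relation.Unary.All using (All; []; _∷_; all?)
open import Data.Maybe using (Maybe; just; nothing; _>>=_)
open import Data.Product using (_×_)
open import Relation.Binary.PropositionalEquality using (_≡_)
open import Relation.Nullary using (¬_; Dec; yes; no)

-- ℤ[T] : coefficient lists, index i = coefficient of T^i

P1 : Set
P1 = List ℤ

infixl 6 _+₁_
_+₁_ : P1 → P1 → P1
[]      +₁ q       = q
(a ∷ p) +₁ []      = a ∷ p
(a ∷ p) +₁ (b ∷ q) = (a ℤ.+ b) ∷ (p +₁ q)

neg₁ : P1 → P1
neg₁ = map (λ a → ℤ.- a)

infixl 7 _*₁_
_*₁_ : P1 → P1 → P1
[]      *₁ q = []
(a ∷ p) *₁ q = map (a ℤ.*_) q +₁ (0ℤ ∷ (p *₁ q))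

-- ℤ[T,U] = ℤ[T][U] : index j of the outer list = coefficient of U^j

P2 : Set
P2 = List P1

infixl 6 _+₂_ _-₂_
_+₂_ : P2 → P2 → P2
[]      +₂ q       = q
(a ∷ p) +₂ []      = a ∷ p
(a ∷ p) +₂ (b ∷ q) = (a +₁ b) ∷ (p +₂ q)

neg₂ : P2 → P2
neg₂ = map neg₁

_-₂_ : P2 → P2 → P2
p -₂ q = p +₂ neg₂ q

infixl 7 _*₂_
_*₂_ : P2 → P2 → P2
[]      *₂ q = []
(a ∷ p) *₂ q = map (a *₁_) q +₂ ([] ∷ (p *₂ q))

infixr 8 _^₂_
_^₂_ : P2 → ℕ → P2
p ^₂ zero  = (1ℤ ∷ []) ∷ []
p ^₂ suc n = p *₂ (p ^₂ n)

const : ℤ → P2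
const c = (c ∷ []) ∷ []

𝟘 𝟙 Tₚ Uₚ : P2
𝟘  = []
𝟙  = const 1ℤ
Tₚ = (0ℤ ∷ 1ℤ ∷ []) ∷ []
Uₚ = [] ∷ (1ℤ ∷ []) ∷ []

IsZero : P2 → Set
IsZero p = All (All (_≡ 0ℤ)) p

isZero? : (p : P2) → Dec (IsZero p)
isZero? = all? (all? (ℤ._≟ 0ℤ))

infix 4 _≈_
_≈_ : P2 → P2 → Set
p ≈ q = IsZero (p -₂ q)

-- C = ℚ(T,U) = Frac(ℤ[T,U]) : fractions with nonzero denominator.
-- Two fractions p/q, p'/q' are equal in C iff p q' ≈ p' q.

record C : Set where
  constructor _/_∣_
  field
    num   : P2
    den   : P2
    den≢0 : ¬ IsZero den
open C public

1≢0 : ¬ IsZero 𝟙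
1≢0 ((() ∷ _) ∷ _)

ι : P2 → C
ι p = p / 𝟙 ∣ 1≢0

-- "a - b = N / D in C", written out by cross-multiplication:
-- a - b = (num a · den b - num b · den a) / (den a · den b)
DiffIs : C → C → P2 → P2 → Set
DiffIs a b N D = (num a *₂ den b -₂ num b *₂ den a) *₂ D ≈ N *₂ (den a *₂ den b)

-- Newton map F(X) = (X² - U)/(2X - T) as a partial map on C:
-- F(p/q) = (p² - U q²) / (q (2p - T q)), undefined when 2x - T = 0 in C,
-- i.e. when 2p - T q is the zero polynomial.

F : C → Maybe C
F (p / q ∣ _) with isZero? (const (+ 2) *₂ p -₂ Tₚ *₂ q)
... | yes _ = nothing
... | no _ with isZero? (q *₂ (const (+ 2) *₂ p -₂ Tₚ *₂ q))
...   | yes _ = nothing  -- cannot occur (ℤ[T,U] is a domain)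
...   | no d≢0 = just ((p *₂ p -₂ Uₚ *₂ (q *₂ q)) / (q *₂ (const (+ 2) *₂ p -₂ Tₚ *₂ q)) ∣ d≢0)

iter : ℕ → C → Maybe C
iter zero    x = just x
iter (suc n) x = iter n x >>= F

h : ℕ → P2
h zero    = Tₚ
h (suc n) = h n *₂ h n -₂ const (+ 2) *₂ (Uₚ ^₂ (2 ℕ.^ n))

H : ℕ → P2
H zero    = h zero
H (suc n) = H n *₂ h (suc n)

-- Write the n-th Newton iterate as p/q, starting from (x₀, 1); the Newton step is
-- (p, q) ↦ (p² − Uq², q(2p − Tq)).  With fₕ = p² − Tpq + Uq² and f′ₕ = 2p − Tq,
-- three ring identities drive everything: fₕ and f′ₕ of the next iterate are
-- fₕ² and f′ₕ² − 2fₕ, and p′q − pq′ = −q fₕ.  Since fₕ(x₀, 1) = U and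
-- f′ₕ(x₀, 1) = ±T for x₀ ∈ {0, T}, induction gives fₕ = U^(2ⁿ), f′ₕ = ±hₙ and
-- q f′ₕ = ±h₀⋯hₙ, hence x_{n+1} − xₙ = −fₕ/(q f′ₕ) = ∓U^(2ⁿ)/(h₀⋯hₙ).  The
-- denominators never vanish because every hₙ evaluates to 1 at T = 1, U = 0.

module Submission where

open import Algebra
  using (CommutativeRing; IsCommutativeRing; AbelianGroup; IsAbelianGroup; RawRing; Op₂)
open import Algebra.Morphism.Structures using (IsRingMonomorphism)
import Algebra.Morphism.RingMonomorphism as RingMonomorphism
open import Data.Empty using (⊥-elim)
open import Data.Integer as ℤ using (ℤ; +_; 0ℤ; 1ℤ)
import Data.Integer.Properties as ℤP
open import Data.List using (List; []; _∷_; map; foldr; drop)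
open import Data.List.Properties using (map-cong)
open import Data.List.Relation.Unary.All as All using (All; []; _∷_)
open import Data.Maybe using (Maybe; just; nothing; _>>=_)
open import Data.Nat as ℕ using (ℕ; zero; suc; _^_; NonZero)
import Data.Nat.Properties as ℕP
open import Data.Product using (Σ; _×_; _,_; proj₁; proj₂)
open import Function using (id)
open import Level using (0ℓ)
open import Relation.Binary.PropositionalEquality as ≡ using (_≡_; _≢_; cong; cong₂)
import Relation.Binary.Reasoning.Setoid
open import Relation.Binary.Structures using (IsEquivalence)
open import Relation.Nullary using (¬_; yes; no)
open import Relation.Nullary.Decidable using (True; toWitness)
open import Tactic.RingSolver.Core.AlmostCommutativeRing using (fromCommutativeRing)
import Tactic.RingSolver.NonReflective as RingSolver

module Polynomial {c ℓ} (R : CommutativeRing c ℓ) where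

  open CommutativeRing R hiding (zero)
  open import Algebra.Properties.Ring ring using (-0#≈0#; -‿+-comm)
  open import Algebra.Properties.CommutativeSemigroup +-commutativeSemigroup
    using (interchange)
  open import Relation.Binary.Reasoning.Setoid setoid

  Poly : Set c
  Poly = List Carrier

  infixl 6 _+ₚ_
  infixl 7 _*ₚ_ _·_
  infix  8 -ₚ_
  infix  4 _≈ₚ_

  _+ₚ_ : Poly → Poly → Poly
  []      +ₚ q       = q
  (a ∷ p) +ₚ []      = a ∷ p
  (a ∷ p) +ₚ (b ∷ q) = (a + b) ∷ (p +ₚ q)

  -ₚ_ : Poly → Poly
  -ₚ_ = map (-_)

  _·_ : Carrier → Poly → Poly
  a · p = map (a *_) p

  _*ₚ_ : Poly → Poly → Poly
  []      *ₚ q = []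
  (a ∷ p) *ₚ q = a · q +ₚ (0# ∷ p *ₚ q)

  0ₚ 1ₚ : Poly
  0ₚ = []
  1ₚ = 1# ∷ []

  coeff : Poly → ℕ → Carrier
  coeff []      _       = 0#
  coeff (a ∷ p) zero    = a
  coeff (a ∷ p) (suc i) = coeff p i

  record _≈ₚ_ (p q : Poly) : Set ℓ where
    constructor mk≈ₚ
    field coeff-≈ : ∀ i → coeff p i ≈ coeff q i
  open _≈ₚ_ public

  ≈ₚ-isEquivalence : IsEquivalence _≈ₚ_
  ≈ₚ-isEquivalence = record
    { refl  = mk≈ₚ λ _ → refl
    ; sym   = λ e → mk≈ₚ λ i → sym (coeff-≈ e i)
    ; trans = λ e f → mk≈ₚ λ i → trans (coeff-≈ e i) (coeff-≈ f i)
    }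

  module ≈ₚ = IsEquivalence ≈ₚ-isEquivalence

  ∷-cong : ∀ {a b p q} → a ≈ b → p ≈ₚ q → a ∷ p ≈ₚ b ∷ q
  ∷-cong a≈b p≈q = mk≈ₚ λ { zero → a≈b ; (suc i) → coeff-≈ p≈q i }

  tail-≈ₚ : ∀ {a p q} → a ∷ p ≈ₚ q → p ≈ₚ drop 1 q
  tail-≈ₚ {q = []}    e = mk≈ₚ λ i → coeff-≈ e (suc i)
  tail-≈ₚ {q = _ ∷ _} e = mk≈ₚ λ i → coeff-≈ e (suc i)

  ∷-≈ₚ0 : ∀ {a p} → a ≈ 0# → p ≈ₚ 0ₚ → a ∷ p ≈ₚ 0ₚ
  ∷-≈ₚ0 a≈0 p≈0 = mk≈ₚ λ { zero → a≈0 ; (suc i) → coeff-≈ p≈0 i }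

  All≈0⇒≈ₚ0 : ∀ {p} → All (_≈ 0#) p → p ≈ₚ 0ₚ
  All≈0⇒≈ₚ0 []         = ≈ₚ.refl
  All≈0⇒≈ₚ0 (a≈0 ∷ p≈0) = ∷-≈ₚ0 a≈0 (All≈0⇒≈ₚ0 p≈0)

  ≈ₚ0⇒All≈0 : ∀ {p} → p ≈ₚ 0ₚ → All (_≈ 0#) p
  ≈ₚ0⇒All≈0 {[]}    _ = []
  ≈ₚ0⇒All≈0 {a ∷ p} e = coeff-≈ e zero ∷ ≈ₚ0⇒All≈0 (tail-≈ₚ e)

  coeff-+ₚ : ∀ p q i → coeff (p +ₚ q) i ≈ coeff p i + coeff q i
  coeff-+ₚ []      q       i       = sym (+-identityˡ _)
  coeff-+ₚ (a ∷ p) []      i       = sym (+-identityʳ _)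
  coeff-+ₚ (a ∷ p) (b ∷ q) zero    = refl
  coeff-+ₚ (a ∷ p) (b ∷ q) (suc i) = coeff-+ₚ p q i

  coeff--ₚ : ∀ p i → coeff (-ₚ p) i ≈ - coeff p i
  coeff--ₚ []      i       = sym -0#≈0#
  coeff--ₚ (a ∷ p) zero    = refl
  coeff--ₚ (a ∷ p) (suc i) = coeff--ₚ p i

  coeff-· : ∀ a p i → coeff (a · p) i ≈ a * coeff p i
  coeff-· a []      i       = sym (zeroʳ a)
  coeff-· a (b ∷ p) zero    = refl
  coeff-· a (b ∷ p) (suc i) = coeff-· a p i

  +ₚ-cong : ∀ {p p′ q q′} → p ≈ₚ p′ → q ≈ₚ q′ → p +ₚ q ≈ₚ p′ +ₚ q′
  +ₚ-cong {p} {p′} {q} {q′} e f = mk≈ₚ λ i → begin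
    coeff (p +ₚ q) i          ≈⟨ coeff-+ₚ p q i ⟩
    coeff p i + coeff q i     ≈⟨ +-cong (coeff-≈ e i) (coeff-≈ f i) ⟩
    coeff p′ i + coeff q′ i   ≈⟨ coeff-+ₚ p′ q′ i ⟨
    coeff (p′ +ₚ q′) i        ∎

  -ₚ-cong : ∀ {p q} → p ≈ₚ q → -ₚ p ≈ₚ -ₚ q
  -ₚ-cong {p} {q} e = mk≈ₚ λ i → begin
    coeff (-ₚ p) i   ≈⟨ coeff--ₚ p i ⟩
    - coeff p i      ≈⟨ -‿cong (coeff-≈ e i) ⟩
    - coeff q i      ≈⟨ coeff--ₚ q i ⟨
    coeff (-ₚ q) i   ∎

  ·-cong : ∀ {a b p q} → a ≈ b → p ≈ₚ q → a · p ≈ₚ b · q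
  ·-cong {a} {b} {p} {q} a≈b e = mk≈ₚ λ i → begin
    coeff (a · p) i   ≈⟨ coeff-· a p i ⟩
    a * coeff p i     ≈⟨ *-cong a≈b (coeff-≈ e i) ⟩
    b * coeff q i     ≈⟨ coeff-· b q i ⟨
    coeff (b · q) i   ∎

  +ₚ-comm : ∀ p q → p +ₚ q ≈ₚ q +ₚ p
  +ₚ-comm p q = mk≈ₚ λ i → begin
    coeff (p +ₚ q) i        ≈⟨ coeff-+ₚ p q i ⟩
    coeff p i + coeff q i   ≈⟨ +-comm _ _ ⟩
    coeff q i + coeff p i   ≈⟨ coeff-+ₚ q p i ⟨
    coeff (q +ₚ p) i        ∎

  +ₚ-assoc : ∀ p q r → (p +ₚ q) +ₚ r ≈ₚ p +ₚ (q +ₚ r)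
  +ₚ-assoc p q r = mk≈ₚ λ i → begin
    coeff ((p +ₚ q) +ₚ r) i                ≈⟨ coeff-+ₚ (p +ₚ q) r i ⟩
    coeff (p +ₚ q) i + coeff r i           ≈⟨ +-congʳ (coeff-+ₚ p q i) ⟩
    (coeff p i + coeff q i) + coeff r i    ≈⟨ +-assoc _ _ _ ⟩
    coeff p i + (coeff q i + coeff r i)    ≈⟨ +-congˡ (coeff-+ₚ q r i) ⟨
    coeff p i + coeff (q +ₚ r) i           ≈⟨ coeff-+ₚ p (q +ₚ r) i ⟨
    coeff (p +ₚ (q +ₚ r)) i                ∎

  +ₚ-identityʳ : ∀ p → p +ₚ 0ₚ ≈ₚ p
  +ₚ-identityʳ []      = ≈ₚ.refl
  +ₚ-identityʳ (a ∷ p) = ≈ₚ.refl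

  -ₚ-inverseˡ : ∀ p → -ₚ p +ₚ p ≈ₚ 0ₚ
  -ₚ-inverseˡ p = mk≈ₚ λ i → begin
    coeff (-ₚ p +ₚ p) i           ≈⟨ coeff-+ₚ (-ₚ p) p i ⟩
    coeff (-ₚ p) i + coeff p i    ≈⟨ +-congʳ (coeff--ₚ p i) ⟩
    - coeff p i + coeff p i       ≈⟨ -‿inverseˡ _ ⟩
    0#                            ∎

  -ₚ-inverseʳ : ∀ p → p +ₚ -ₚ p ≈ₚ 0ₚ
  -ₚ-inverseʳ p = ≈ₚ.trans (+ₚ-comm p (-ₚ p)) (-ₚ-inverseˡ p)

  +ₚ-isAbelianGroup : IsAbelianGroup _≈ₚ_ _+ₚ_ 0ₚ -ₚ_
  +ₚ-isAbelianGroup = record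
    { isGroup = record
      { isMonoid = record
        { isSemigroup = record
          { isMagma  = record { isEquivalence = ≈ₚ-isEquivalence ; ∙-cong = +ₚ-cong }
          ; assoc    = +ₚ-assoc
          }
        ; identity = (λ _ → ≈ₚ.refl) , +ₚ-identityʳ
        }
      ; inverse = -ₚ-inverseˡ , -ₚ-inverseʳ
      ; ⁻¹-cong = -ₚ-cong
      }
    ; comm = +ₚ-comm
    }

  +ₚ-abelianGroup : AbelianGroup c ℓ
  +ₚ-abelianGroup = record { isAbelianGroup = +ₚ-isAbelianGroup }

  open import Algebra.Properties.CommutativeSemigroup
    (AbelianGroup.commutativeSemigroup +ₚ-abelianGroup)
    using () renaming (interchange to +ₚ-interchange; x∙yz≈y∙xz to +ₚ-swap)

  ·-zero : ∀ {a} p → a ≈ 0# → a · p ≈ₚ 0ₚ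
  ·-zero {a} p a≈0 = mk≈ₚ λ i → begin
    coeff (a · p) i   ≈⟨ coeff-· a p i ⟩
    a * coeff p i     ≈⟨ *-congʳ a≈0 ⟩
    0# * coeff p i    ≈⟨ zeroˡ _ ⟩
    0#                ∎

  ·-identity : ∀ p → 1# · p ≈ₚ p
  ·-identity p = mk≈ₚ λ i → trans (coeff-· 1# p i) (*-identityˡ _)

  ·-assoc : ∀ a b p → a · (b · p) ≈ₚ (a * b) · p
  ·-assoc a b p = mk≈ₚ λ i → begin
    coeff (a · (b · p)) i    ≈⟨ coeff-· a (b · p) i ⟩
    a * coeff (b · p) i      ≈⟨ *-congˡ (coeff-· b p i) ⟩
    a * (b * coeff p i)      ≈⟨ *-assoc _ _ _ ⟨
    (a * b) * coeff p i      ≈⟨ coeff-· (a * b) p i ⟨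
    coeff ((a * b) · p) i    ∎

  ·-distribˡ : ∀ a p q → a · (p +ₚ q) ≈ₚ a · p +ₚ a · q
  ·-distribˡ a p q = mk≈ₚ λ i → begin
    coeff (a · (p +ₚ q)) i                ≈⟨ coeff-· a (p +ₚ q) i ⟩
    a * coeff (p +ₚ q) i                  ≈⟨ *-congˡ (coeff-+ₚ p q i) ⟩
    a * (coeff p i + coeff q i)           ≈⟨ distribˡ _ _ _ ⟩
    a * coeff p i + a * coeff q i         ≈⟨ +-cong (coeff-· a p i) (coeff-· a q i) ⟨
    coeff (a · p) i + coeff (a · q) i     ≈⟨ coeff-+ₚ (a · p) (a · q) i ⟨
    coeff (a · p +ₚ a · q) i              ∎

  ·-distribʳ : ∀ a b p → (a + b) · p ≈ₚ a · p +ₚ b · p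
  ·-distribʳ a b p = mk≈ₚ λ i → begin
    coeff ((a + b) · p) i                 ≈⟨ coeff-· (a + b) p i ⟩
    (a + b) * coeff p i                   ≈⟨ distribʳ _ _ _ ⟩
    a * coeff p i + b * coeff p i         ≈⟨ +-cong (coeff-· a p i) (coeff-· b p i) ⟨
    coeff (a · p) i + coeff (b · p) i     ≈⟨ coeff-+ₚ (a · p) (b · p) i ⟨
    coeff (a · p +ₚ b · p) i              ∎

  0∷-+ₚ : ∀ p q → 0# ∷ (p +ₚ q) ≈ₚ (0# ∷ p) +ₚ (0# ∷ q)
  0∷-+ₚ p q = ∷-cong (sym (+-identityʳ 0#)) ≈ₚ.refl

  *ₚ-zeroʳ : ∀ p → p *ₚ 0ₚ ≈ₚ 0ₚ
  *ₚ-zeroʳ []      = ≈ₚ.refl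
  *ₚ-zeroʳ (a ∷ p) = ∷-≈ₚ0 refl (*ₚ-zeroʳ p)

  *ₚ-≈ₚ0 : ∀ {p} r → p ≈ₚ 0ₚ → p *ₚ r ≈ₚ 0ₚ
  *ₚ-≈ₚ0 {[]}    r e = ≈ₚ.refl
  *ₚ-≈ₚ0 {a ∷ p} r e = +ₚ-cong (·-zero r (coeff-≈ e zero)) (∷-≈ₚ0 refl (*ₚ-≈ₚ0 r (tail-≈ₚ e)))

  *ₚ-congʳ : ∀ {p p′} r → p ≈ₚ p′ → p *ₚ r ≈ₚ p′ *ₚ r
  *ₚ-congʳ {[]}    {[]}     r e = ≈ₚ.refl
  *ₚ-congʳ {[]}    {b ∷ q}  r e = ≈ₚ.sym (*ₚ-≈ₚ0 r (≈ₚ.sym e))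
  *ₚ-congʳ {a ∷ p} {[]}     r e = *ₚ-≈ₚ0 r e
  *ₚ-congʳ {a ∷ p} {b ∷ q}  r e =
    +ₚ-cong (·-cong (coeff-≈ e zero) ≈ₚ.refl) (∷-cong refl (*ₚ-congʳ r (tail-≈ₚ e)))

  *ₚ-∷ʳ : ∀ p b q → p *ₚ (b ∷ q) ≈ₚ b · p +ₚ (0# ∷ p *ₚ q)
  *ₚ-∷ʳ []      b q = ≈ₚ.sym (∷-≈ₚ0 refl ≈ₚ.refl)
  *ₚ-∷ʳ (a ∷ p) b q = ∷-cong (+-congʳ (*-comm a b))
    (≈ₚ.trans (+ₚ-cong ≈ₚ.refl (*ₚ-∷ʳ p b q)) (+ₚ-swap (a · q) (b · p) (0# ∷ p *ₚ q)))

  *ₚ-comm : ∀ p q → p *ₚ q ≈ₚ q *ₚ p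
  *ₚ-comm []      q = ≈ₚ.sym (*ₚ-zeroʳ q)
  *ₚ-comm (a ∷ p) q =
    ≈ₚ.trans (+ₚ-cong ≈ₚ.refl (∷-cong refl (*ₚ-comm p q))) (≈ₚ.sym (*ₚ-∷ʳ q a p))

  *ₚ-cong : ∀ {p p′ q q′} → p ≈ₚ p′ → q ≈ₚ q′ → p *ₚ q ≈ₚ p′ *ₚ q′
  *ₚ-cong {p} {p′} {q} {q′} e f = ≈ₚ.trans (*ₚ-congʳ q e)
    (≈ₚ.trans (*ₚ-comm p′ q) (≈ₚ.trans (*ₚ-congʳ p′ f) (*ₚ-comm q′ p′)))

  *ₚ-distribʳ : ∀ r p q → (p +ₚ q) *ₚ r ≈ₚ p *ₚ r +ₚ q *ₚ r
  *ₚ-distribʳ r []      q       = ≈ₚ.refl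
  *ₚ-distribʳ r (a ∷ p) []      = ≈ₚ.sym (+ₚ-identityʳ _)
  *ₚ-distribʳ r (a ∷ p) (b ∷ q) = ≈ₚ.trans
    (+ₚ-cong (·-distribʳ a b r)
             (≈ₚ.trans (∷-cong refl (*ₚ-distribʳ r p q)) (0∷-+ₚ (p *ₚ r) (q *ₚ r))))
    (+ₚ-interchange (a · r) (b · r) (0# ∷ p *ₚ r) (0# ∷ q *ₚ r))

  *ₚ-distribˡ : ∀ r p q → r *ₚ (p +ₚ q) ≈ₚ r *ₚ p +ₚ r *ₚ q
  *ₚ-distribˡ r p q = ≈ₚ.trans (*ₚ-comm r (p +ₚ q))
    (≈ₚ.trans (*ₚ-distribʳ r p q) (+ₚ-cong (*ₚ-comm p r) (*ₚ-comm q r)))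

  0∷-*ₚ : ∀ p q → (0# ∷ p) *ₚ q ≈ₚ 0# ∷ p *ₚ q
  0∷-*ₚ p q = +ₚ-cong (·-zero q refl) ≈ₚ.refl

  ·-*ₚ : ∀ a p q → (a · p) *ₚ q ≈ₚ a · (p *ₚ q)
  ·-*ₚ a []      q = ≈ₚ.refl
  ·-*ₚ a (b ∷ p) q = ≈ₚ.sym (≈ₚ.trans (·-distribˡ a (b · q) (0# ∷ p *ₚ q))
    (+ₚ-cong (·-assoc a b q) (∷-cong (zeroʳ a) (≈ₚ.sym (·-*ₚ a p q)))))

  *ₚ-assoc : ∀ p q r → (p *ₚ q) *ₚ r ≈ₚ p *ₚ (q *ₚ r)
  *ₚ-assoc []      q r = ≈ₚ.refl
  *ₚ-assoc (a ∷ p) q r = ≈ₚ.trans (*ₚ-distribʳ r (a · q) (0# ∷ p *ₚ q))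
    (+ₚ-cong (·-*ₚ a q r) (≈ₚ.trans (0∷-*ₚ (p *ₚ q) r) (∷-cong refl (*ₚ-assoc p q r))))

  *ₚ-identityˡ : ∀ p → 1ₚ *ₚ p ≈ₚ p
  *ₚ-identityˡ p = ≈ₚ.trans (+ₚ-cong (·-identity p) (∷-≈ₚ0 refl ≈ₚ.refl)) (+ₚ-identityʳ p)

  +ₚ-*ₚ-isCommutativeRing : IsCommutativeRing _≈ₚ_ _+ₚ_ _*ₚ_ -ₚ_ 0ₚ 1ₚ
  +ₚ-*ₚ-isCommutativeRing = record
    { isRing = record
      { +-isAbelianGroup = +ₚ-isAbelianGroup
      ; *-cong           = *ₚ-cong
      ; *-assoc          = *ₚ-assoc
      ; *-identity       = *ₚ-identityˡ , λ p → ≈ₚ.trans (*ₚ-comm p 1ₚ) (*ₚ-identityˡ p)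
      ; distrib          = *ₚ-distribˡ , *ₚ-distribʳ
      }
    ; *-comm = *ₚ-comm
    }

  +ₚ-*ₚ-commutativeRing : CommutativeRing c ℓ
  +ₚ-*ₚ-commutativeRing = record { isCommutativeRing = +ₚ-*ₚ-isCommutativeRing }

  coeff₀-*ₚ : ∀ p q → coeff (p *ₚ q) 0 ≈ coeff p 0 * coeff q 0
  coeff₀-*ₚ []      q = sym (zeroˡ _)
  coeff₀-*ₚ (a ∷ p) q = begin
    coeff (a · q +ₚ (0# ∷ p *ₚ q)) 0   ≈⟨ coeff-+ₚ (a · q) _ 0 ⟩
    coeff (a · q) 0 + 0#               ≈⟨ +-identityʳ _ ⟩
    coeff (a · q) 0                    ≈⟨ coeff-· a q 0 ⟩
    a * coeff q 0                      ∎

  eval₁ : Poly → Carrier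
  eval₁ = foldr _+_ 0#

  eval₁-≈ₚ0 : ∀ {p} → p ≈ₚ 0ₚ → eval₁ p ≈ 0#
  eval₁-≈ₚ0 {[]}    e = refl
  eval₁-≈ₚ0 {a ∷ p} e = trans (+-cong (coeff-≈ e zero) (eval₁-≈ₚ0 (tail-≈ₚ e))) (+-identityʳ 0#)

  eval₁-cong : ∀ {p q} → p ≈ₚ q → eval₁ p ≈ eval₁ q
  eval₁-cong {[]}    {[]}    e = refl
  eval₁-cong {[]}    {b ∷ q} e = sym (eval₁-≈ₚ0 (≈ₚ.sym e))
  eval₁-cong {a ∷ p} {[]}    e = eval₁-≈ₚ0 e
  eval₁-cong {a ∷ p} {b ∷ q} e = +-cong (coeff-≈ e zero) (eval₁-cong (tail-≈ₚ e))

  eval₁-+ₚ : ∀ p q → eval₁ (p +ₚ q) ≈ eval₁ p + eval₁ q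
  eval₁-+ₚ []      q       = sym (+-identityˡ _)
  eval₁-+ₚ (a ∷ p) []      = sym (+-identityʳ _)
  eval₁-+ₚ (a ∷ p) (b ∷ q) =
    trans (+-congˡ (eval₁-+ₚ p q)) (interchange a b (eval₁ p) (eval₁ q))

  eval₁--ₚ : ∀ p → eval₁ (-ₚ p) ≈ - eval₁ p
  eval₁--ₚ []      = sym -0#≈0#
  eval₁--ₚ (a ∷ p) = trans (+-congˡ (eval₁--ₚ p)) (-‿+-comm a (eval₁ p))

  eval₁-· : ∀ a p → eval₁ (a · p) ≈ a * eval₁ p
  eval₁-· a []      = sym (zeroʳ a)
  eval₁-· a (b ∷ p) = trans (+-congˡ (eval₁-· a p)) (sym (distribˡ a b (eval₁ p)))

  eval₁-*ₚ : ∀ p q → eval₁ (p *ₚ q) ≈ eval₁ p * eval₁ q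
  eval₁-*ₚ []      q = sym (zeroˡ _)
  eval₁-*ₚ (a ∷ p) q = begin
    eval₁ (a · q +ₚ (0# ∷ p *ₚ q))           ≈⟨ eval₁-+ₚ (a · q) (0# ∷ p *ₚ q) ⟩
    eval₁ (a · q) + (0# + eval₁ (p *ₚ q))    ≈⟨ +-cong (eval₁-· a q) (+-identityˡ _) ⟩
    a * eval₁ q + eval₁ (p *ₚ q)             ≈⟨ +-congˡ (eval₁-*ₚ p q) ⟩
    a * eval₁ q + eval₁ p * eval₁ q          ≈⟨ distribʳ (eval₁ q) a (eval₁ p) ⟨
    (a + eval₁ p) * eval₁ q                  ∎

module _ {c ℓ} (R : CommutativeRing c ℓ) where

  open CommutativeRing R

  isCommutativeRing-≗ : {_+′_ _*′_ : Op₂ Carrier} →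
    (∀ x y → x +′ y ≡ x + y) → (∀ x y → x *′ y ≡ x * y) →
    IsCommutativeRing _≈_ _+′_ _*′_ -_ 0# 1#
  isCommutativeRing-≗ {_+′_} {_*′_} +′≗+ *′≗* =
    RingMonomorphism.isCommutativeRing id-isRingMonomorphism isCommutativeRing
    where
    rawRing′ : RawRing c ℓ
    rawRing′ = record
      { _≈_ = _≈_ ; _+_ = _+′_ ; _*_ = _*′_ ; -_ = -_ ; 0# = 0# ; 1# = 1# }

    id-isRingMonomorphism : IsRingMonomorphism rawRing′ rawRing id
    id-isRingMonomorphism = record
      { isRingHomomorphism = record
        { isSemiringHomomorphism = record
          { isNearSemiringHomomorphism = record
            { +-isMonoidHomomorphism = record
              { isMagmaHomomorphism = record
                { isRelHomomorphism = record { cong = id }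
                ; homo = λ x y → reflexive (+′≗+ x y)
                }
              ; ε-homo = refl
              }
            ; *-homo = λ x y → reflexive (*′≗* x y)
            }
          ; 1#-homo = refl
          }
        ; -‿homo = λ _ → refl
        }
      ; injective = id
      }

open import Defs

module ℤ[T] = Polynomial ℤP.+-*-commutativeRing
module ℤ[T][U] = Polynomial ℤ[T].+ₚ-*ₚ-commutativeRing

+₁≡+ₚ : ∀ p q → p +₁ q ≡ p ℤ[T].+ₚ q
+₁≡+ₚ []      q       = ≡.refl
+₁≡+ₚ (a ∷ p) []      = ≡.refl
+₁≡+ₚ (a ∷ p) (b ∷ q) = cong (a ℤ.+ b ∷_) (+₁≡+ₚ p q)

*₁≡*ₚ : ∀ p q → p *₁ q ≡ p ℤ[T].*ₚ q
*₁≡*ₚ []      q = ≡.refl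
*₁≡*ₚ (a ∷ p) q = ≡.trans (+₁≡+ₚ (a ℤ[T].· q) (0ℤ ∷ p *₁ q))
  (cong (λ r → a ℤ[T].· q ℤ[T].+ₚ (0ℤ ∷ r)) (*₁≡*ₚ p q))

+₂≡+ₚ : ∀ x y → x +₂ y ≡ x ℤ[T][U].+ₚ y
+₂≡+ₚ []      y       = ≡.refl
+₂≡+ₚ (a ∷ x) []      = ≡.refl
+₂≡+ₚ (a ∷ x) (b ∷ y) = cong₂ _∷_ (+₁≡+ₚ a b) (+₂≡+ₚ x y)

*₂≡*ₚ : ∀ x y → x *₂ y ≡ x ℤ[T][U].*ₚ y
*₂≡*ₚ []      y = ≡.refl
*₂≡*ₚ (a ∷ x) y = ≡.trans (+₂≡+ₚ (map (a *₁_) y) ([] ∷ x *₂ y))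
  (cong₂ (λ s r → s ℤ[T][U].+ₚ ([] ∷ r)) (map-cong (*₁≡*ₚ a) y) (*₂≡*ₚ x y))

ℤ[T,U] : CommutativeRing 0ℓ 0ℓ
ℤ[T,U] = record
  { isCommutativeRing = isCommutativeRing-≗ ℤ[T][U].+ₚ-*ₚ-commutativeRing +₂≡+ₚ *₂≡*ₚ }

open CommutativeRing ℤ[T,U]
  using ( refl; sym; trans; reflexive; setoid; ring; +-cong; +-congʳ; -‿cong; -‿inverseʳ
        ; *-cong; *-congˡ; *-congʳ; *-assoc; *-identityˡ; zeroˡ; zeroʳ )
  renaming (_≈_ to _≋_)
open import Algebra.Properties.Ring ring using (x∙y⁻¹≈ε⇒x≈y)

module ≋-Reasoning = Relation.Binary.Reasoning.Setoid setoid

isZero⇒≋𝟘 : ∀ {x} → IsZero x → x ≋ 𝟘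
isZero⇒≋𝟘 x≈0 = ℤ[T][U].All≈0⇒≈ₚ0 (All.map ℤ[T].All≈0⇒≈ₚ0 x≈0)

≋𝟘⇒isZero : ∀ {x} → x ≋ 𝟘 → IsZero x
≋𝟘⇒isZero x≋0 = All.map ℤ[T].≈ₚ0⇒All≈0 (ℤ[T][U].≈ₚ0⇒All≈0 x≋0)

≋⇒≈ : ∀ {x y} → x ≋ y → x ≈ y
≋⇒≈ {x} {y} x≋y = ≋𝟘⇒isZero (trans (+-congʳ x≋y) (-‿inverseʳ y))

≈⇒≋ : ∀ {x y} → x ≈ y → x ≋ y
≈⇒≋ {x} {y} x≈y = x∙y⁻¹≈ε⇒x≈y x y (isZero⇒≋𝟘 x≈y)

decide : ∀ {x y} → True (isZero? (x -₂ y)) → x ≋ y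
decide x-y≟0 = ≈⇒≋ (toWitness x-y≟0)

isZero-*ʳ : ∀ x {y} → IsZero y → IsZero (x *₂ y)
isZero-*ʳ x y≈0 = ≋𝟘⇒isZero (trans (*-congˡ {x} (isZero⇒≋𝟘 y≈0)) (zeroʳ x))

^₂-+ : ∀ x a b → x ^₂ (a ℕ.+ b) ≋ x ^₂ a *₂ x ^₂ b
^₂-+ x zero    b = sym (*-identityˡ _)
^₂-+ x (suc a) b = trans (*-congˡ {x} (^₂-+ x a b)) (sym (*-assoc x (x ^₂ a) (x ^₂ b)))

^₂-double : ∀ x m → x ^₂ (2 ℕ.* m) ≋ x ^₂ m *₂ x ^₂ m
^₂-double x m =
  trans (^₂-+ x m (m ℕ.+ 0)) (*-congˡ {x ^₂ m} (reflexive (cong (x ^₂_) (ℕP.+-identityʳ m))))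

𝟚 : P2
𝟚 = const (+ 2)

open ℤ[T] using (eval₁; eval₁-cong; eval₁-+ₚ; eval₁--ₚ; eval₁-*ₚ)

coeff₀ : P2 → P1
coeff₀ x = ℤ[T][U].coeff x 0

-- Evaluation at T = 1, U = 0.
eval : P2 → ℤ
eval x = eval₁ (coeff₀ x)

eval-cong : ∀ {x y} → x ≋ y → eval x ≡ eval y
eval-cong x≋y = eval₁-cong (ℤ[T][U].coeff-≈ x≋y 0)

eval-+₂ : ∀ x y → eval (x +₂ y) ≡ eval x ℤ.+ eval y
eval-+₂ x y = begin
  eval (x +₂ y)                          ≡⟨ cong eval (+₂≡+ₚ x y) ⟩
  eval (x ℤ[T][U].+ₚ y)                  ≡⟨ eval₁-cong (ℤ[T][U].coeff-+ₚ x y 0) ⟩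
  eval₁ (coeff₀ x ℤ[T].+ₚ coeff₀ y)      ≡⟨ eval₁-+ₚ (coeff₀ x) (coeff₀ y) ⟩
  eval x ℤ.+ eval y                      ∎
  where open ≡.≡-Reasoning

eval-neg₂ : ∀ x → eval (neg₂ x) ≡ ℤ.- eval x
eval-neg₂ x = ≡.trans (eval₁-cong (ℤ[T][U].coeff--ₚ x 0)) (eval₁--ₚ (coeff₀ x))

eval-*₂ : ∀ x y → eval (x *₂ y) ≡ eval x ℤ.* eval y
eval-*₂ x y = begin
  eval (x *₂ y)                          ≡⟨ cong eval (*₂≡*ₚ x y) ⟩
  eval (x ℤ[T][U].*ₚ y)                  ≡⟨ eval₁-cong (ℤ[T][U].coeff₀-*ₚ x y) ⟩
  eval₁ (coeff₀ x ℤ[T].*ₚ coeff₀ y)      ≡⟨ eval₁-*ₚ (coeff₀ x) (coeff₀ y) ⟩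
  eval x ℤ.* eval y                      ∎
  where open ≡.≡-Reasoning

eval-Uₚ^ : ∀ k .{{_ : NonZero k}} → eval (Uₚ ^₂ k) ≡ 0ℤ
eval-Uₚ^ (suc k) = ≡.trans (eval-*₂ Uₚ (Uₚ ^₂ k)) (ℤP.*-zeroˡ (eval (Uₚ ^₂ k)))

eval-h : ∀ n → eval (h n) ≡ 1ℤ
eval-h zero    = ≡.refl
eval-h (suc n) = begin
  eval (h n *₂ h n -₂ 𝟚Uᵐ)
    ≡⟨ eval-+₂ (h n *₂ h n) (neg₂ 𝟚Uᵐ) ⟩
  eval (h n *₂ h n) ℤ.+ eval (neg₂ 𝟚Uᵐ)
    ≡⟨ cong₂ ℤ._+_ (eval-*₂ (h n) (h n)) (≡.trans (eval-neg₂ 𝟚Uᵐ) (cong ℤ.-_ (eval-*₂ 𝟚 Uᵐ))) ⟩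
  eval (h n) ℤ.* eval (h n) ℤ.+ ℤ.- (+ 2 ℤ.* eval Uᵐ)
    ≡⟨ cong₂ (λ a b → a ℤ.* a ℤ.+ ℤ.- (+ 2 ℤ.* b)) (eval-h n) (eval-Uₚ^ (2 ^ n) {{ℕP.m^n≢0 2 n}}) ⟩
  1ℤ
    ∎
  where
  open ≡.≡-Reasoning
  Uᵐ 𝟚Uᵐ : P2
  Uᵐ  = Uₚ ^₂ (2 ^ n)
  𝟚Uᵐ = 𝟚 *₂ Uᵐ

eval-H : ∀ n → eval (H n) ≡ 1ℤ
eval-H zero    = ≡.refl
eval-H (suc n) = ≡.trans (eval-*₂ (H n) (h (suc n))) (cong₂ ℤ._*_ (eval-H n) (eval-h (suc n)))

¬IsZero-factor : ∀ {x y z} → x *₂ y ≋ z → eval z ≢ 0ℤ → ¬ IsZero x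
¬IsZero-factor {x} {y} {z} xy≋z eval-z≢0 x≈0 =
  eval-z≢0 (eval-cong (trans (sym xy≋z) (trans (*-congʳ (isZero⇒≋𝟘 x≈0)) (zeroˡ y))))

-- The solver's coefficients are elements of ℤ[T,U] itself (such as 𝟚 below);
-- deciding IsZero lets it cancel them.
𝟘≟ : (x : P2) → Maybe (𝟘 ≋ x)
𝟘≟ x with isZero? x
... | yes x≈0 = just (sym (isZero⇒≋𝟘 x≈0))
... | no  _   = nothing

open RingSolver (fromCommutativeRing ℤ[T,U] 𝟘≟) using (solve; _⊜_; _⊕_; _⊗_; ⊝_; Κ; Expr)

-- For x = p/q and f = X² − TX + U:  fₕ p q = q² f(x),  f′ₕ p q = q f′(x),
-- and F(x) = newton-num p q / newton-den p q.
fₕ f′ₕ newton-num newton-den : P2 → P2 → P2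
fₕ p q         = p *₂ p -₂ Tₚ *₂ p *₂ q +₂ Uₚ *₂ q *₂ q
f′ₕ p q        = 𝟚 *₂ p -₂ Tₚ *₂ q
newton-num p q = p *₂ p -₂ Uₚ *₂ (q *₂ q)
newton-den p q = q *₂ f′ₕ p q

module NewtonExpr {n} (t u : Expr P2 n) where
  fₑ f′ₑ numₑ denₑ : Expr P2 n → Expr P2 n → Expr P2 n
  fₑ p q   = p ⊗ p ⊕ ⊝ (t ⊗ p ⊗ q) ⊕ u ⊗ q ⊗ q
  f′ₑ p q  = Κ 𝟚 ⊗ p ⊕ ⊝ (t ⊗ q)
  numₑ p q = p ⊗ p ⊕ ⊝ (u ⊗ (q ⊗ q))
  denₑ p q = q ⊗ f′ₑ p q

fₕ-newton : ∀ p q → fₕ (newton-num p q) (newton-den p q) ≋ fₕ p q *₂ fₕ p q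
fₕ-newton p q = solve 4 (λ p q t u → let open NewtonExpr t u in
  fₑ (numₑ p q) (denₑ p q) ⊜ (fₑ p q ⊗ fₑ p q)) refl p q Tₚ Uₚ

f′ₕ-newton : ∀ p q →
  f′ₕ (newton-num p q) (newton-den p q) ≋ f′ₕ p q *₂ f′ₕ p q -₂ 𝟚 *₂ fₕ p q
f′ₕ-newton p q = solve 4 (λ p q t u → let open NewtonExpr t u in
  f′ₑ (numₑ p q) (denₑ p q) ⊜ (f′ₑ p q ⊗ f′ₑ p q ⊕ ⊝ (Κ 𝟚 ⊗ fₑ p q))) refl p q Tₚ Uₚ

newton-cross : ∀ p q → newton-num p q *₂ q -₂ p *₂ newton-den p q ≋ neg₂ (q *₂ fₕ p q)
newton-cross p q = solve 4 (λ p q t u → let open NewtonExpr t u in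
  (numₑ p q ⊗ q ⊕ ⊝ (p ⊗ denₑ p q)) ⊜ ⊝ (q ⊗ fₑ p q)) refl p q Tₚ Uₚ

F-at : ∀ p q (q≢0 : ¬ IsZero q) → ¬ IsZero (newton-den p q) →
  Σ (¬ IsZero (newton-den p q)) λ d≢0 →
    F (p / q ∣ q≢0) ≡ just (newton-num p q / newton-den p q ∣ d≢0)
F-at p q q≢0 d≢0 with isZero? (const (+ 2) *₂ p -₂ Tₚ *₂ q)
... | yes f′≈0 = ⊥-elim (d≢0 (isZero-*ʳ q f′≈0))
... | no _ with isZero? (q *₂ (const (+ 2) *₂ p -₂ Tₚ *₂ q))
...   | yes d≈0  = ⊥-elim (d≢0 d≈0)
...   | no  d≢0′ = d≢0′ , ≡.refl

-- ε = ±1 is the sign with f′ₕ x₀ 1 = ε h₀; since f′ₕ = hₙ exactly only from the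
-- first step on, the invariant records f′ₕ squared.
module Orbit (x₀ ε : P2) (ε²≋𝟙 : ε *₂ ε ≋ 𝟙) where

  record Iterate (n : ℕ) : Set where
    field
      p q   : P2
      q≢0   : ¬ IsZero q
      iter≡ : iter n (ι x₀) ≡ just (p / q ∣ q≢0)
      fₕ≋   : fₕ p q ≋ Uₚ ^₂ (2 ^ n)
      f′ₕ²≋ : f′ₕ p q *₂ f′ₕ p q ≋ h n *₂ h n
      den≋  : newton-den p q ≋ ε *₂ H n

    point : C
    point = p / q ∣ q≢0

  start : fₕ x₀ 𝟙 ≋ Uₚ ^₂ 1 → f′ₕ x₀ 𝟙 *₂ f′ₕ x₀ 𝟙 ≋ h 0 *₂ h 0 →
          newton-den x₀ 𝟙 ≋ ε *₂ H 0 → Iterate 0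
  start fₕ≋ f′ₕ²≋ den≋ = record
    { p = x₀ ; q = 𝟙 ; q≢0 = 1≢0 ; iter≡ = ≡.refl ; fₕ≋ = fₕ≋ ; f′ₕ²≋ = f′ₕ²≋ ; den≋ = den≋ }

  εxε≋x : ∀ x → (ε *₂ x) *₂ ε ≋ x
  εxε≋x x = begin
    (ε *₂ x) *₂ ε   ≈⟨ solve 2 (λ e x → (e ⊗ x) ⊗ e ⊜ (e ⊗ e) ⊗ x) refl ε x ⟩
    (ε *₂ ε) *₂ x   ≈⟨ *-congʳ ε²≋𝟙 ⟩
    𝟙 *₂ x          ≈⟨ *-identityˡ x ⟩
    x               ∎
    where open ≋-Reasoning

  module _ {n} (I : Iterate n) where

    open Iterate I

    newton-den≢0 : ¬ IsZero (newton-den p q)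
    newton-den≢0 = ¬IsZero-factor (trans (*-congʳ den≋) (εxε≋x (H n)))
      (λ eval≡0 → 1ℤ≢0ℤ (≡.trans (≡.sym (eval-H n)) eval≡0))
      where
      1ℤ≢0ℤ : 1ℤ ≢ 0ℤ
      1ℤ≢0ℤ ()

    F-at-point : Σ (¬ IsZero (newton-den p q)) λ d≢0 →
                   F point ≡ just (newton-num p q / newton-den p q ∣ d≢0)
    F-at-point = F-at p q q≢0 newton-den≢0

    f′ₕ-next≋h : f′ₕ (newton-num p q) (newton-den p q) ≋ h (suc n)
    f′ₕ-next≋h = trans (f′ₕ-newton p q) (+-cong f′ₕ²≋ (-‿cong (*-congˡ {𝟚} fₕ≋)))

    next : Iterate (suc n)
    next = record
      { p     = newton-num p q
      ; q     = newton-den p q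
      ; q≢0   = proj₁ F-at-point
      ; iter≡ = ≡.trans (cong (_>>= F) iter≡) (proj₂ F-at-point)
      ; fₕ≋   = trans (fₕ-newton p q) (trans (*-cong fₕ≋ fₕ≋) (sym (^₂-double Uₚ (2 ^ n))))
      ; f′ₕ²≋ = *-cong f′ₕ-next≋h f′ₕ-next≋h
      ; den≋  = trans (*-cong den≋ f′ₕ-next≋h) (*-assoc ε (H n) (h (suc n)))
      }

    difference : ∀ {N} → N ≋ neg₂ (ε *₂ Uₚ ^₂ (2 ^ n)) →
                 DiffIs (Iterate.point next) point N (H n)
    difference {N} N≋ = ≋⇒≈ (begin
      (newton-num p q *₂ q -₂ p *₂ newton-den p q) *₂ H n
        ≈⟨ *-congʳ {H n} (newton-cross p q) ⟩
      neg₂ (q *₂ fₕ p q) *₂ H n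
        ≈⟨ *-congʳ {H n} (-‿cong (*-congˡ {q} fₕ≋)) ⟩
      neg₂ (q *₂ Uᵐ) *₂ H n
        ≈⟨ *-congʳ {H n} (-‿cong (trans (*-congʳ {q *₂ Uᵐ} ε²≋𝟙) (*-identityˡ (q *₂ Uᵐ)))) ⟨
      neg₂ ((ε *₂ ε) *₂ (q *₂ Uᵐ)) *₂ H n
        ≈⟨ solve 4 (λ e q x k → ⊝ (e ⊗ x) ⊗ ((e ⊗ k) ⊗ q) ⊜ ⊝ ((e ⊗ e) ⊗ (q ⊗ x)) ⊗ k)
                   refl ε q Uᵐ (H n) ⟨
      neg₂ (ε *₂ Uᵐ) *₂ ((ε *₂ H n) *₂ q)
        ≈⟨ *-cong N≋ (*-congʳ {q} den≋) ⟨
      N *₂ (newton-den p q *₂ q)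
        ∎)
      where
      open ≋-Reasoning
      Uᵐ : P2
      Uᵐ = Uₚ ^₂ (2 ^ n)

  iterate : Iterate 0 → ∀ n → Iterate n
  iterate I₀ zero    = I₀
  iterate I₀ (suc n) = next (iterate I₀ n)

  consecutive-difference : Iterate 0 → ∀ n {N} → N ≋ neg₂ (ε *₂ Uₚ ^₂ (2 ^ n)) →
    Σ C λ a → Σ C λ b → iter (suc n) (ι x₀) ≡ just a × iter n (ι x₀) ≡ just b × DiffIs a b N (H n)
  consecutive-difference I₀ n N≋ =
    point (next Iₙ) , point Iₙ , iter≡ (next Iₙ) , iter≡ Iₙ , difference Iₙ N≋
    where
    open Iterate
    Iₙ : Iterate n
    Iₙ = iterate I₀ n

lemma3p1 : (n : ℕ) →
    (Σ C λ a → Σ C λ b → iter (suc n) (ι 𝟘) ≡ just a × iter n (ι 𝟘) ≡ just b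
    × DiffIs a b (Uₚ ^₂ (2 ^ n)) (H n))
    × (Σ C λ a → Σ C λ b → iter (suc n) (ι Tₚ) ≡ just a × iter n (ι Tₚ) ≡ just b
    × DiffIs a b (neg₂ (Uₚ ^₂ (2 ^ n))) (H n))
lemma3p1 n =
  Orbit.consecutive-difference 𝟘 (neg₂ 𝟙) (decide _) start₀ n
    (solve 1 (λ x → x ⊜ ⊝ (⊝ (Κ 𝟙) ⊗ x)) refl Uᵐ) ,
  Orbit.consecutive-difference Tₚ 𝟙 (decide _) startₜ n (-‿cong (sym (*-identityˡ Uᵐ)))
  where
  Uᵐ : P2
  Uᵐ = Uₚ ^₂ (2 ^ n)
  start₀ : Orbit.Iterate 𝟘 (neg₂ 𝟙) (decide _) 0
  start₀ = Orbit.start 𝟘 (neg₂ 𝟙) (decide _) (decide _) (decide _) (decide _)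
  startₜ : Orbit.Iterate Tₚ 𝟙 (decide _) 0
  startₜ = Orbit.start Tₚ 𝟙 (decide _) (decide _) (decide _) (decide _)
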